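{- Let $n\ge 2$, $\sigma\in\mathfrak S_n$, and let $\partial\mathbf F_\sigma(\mathbb X):=\mathbf F_{\mathrm{std}(\sigma_1\cdots\sigma_{n-1})}(\mathbb X)$. Then, with the convention $\sigma_0=+\infty$, $$\mathbf F_\sigma(\mathbb X)=\partial\mathbf F_\sigma(\mathbb X)\times\begin{cases}\dfrac{1-q^{n-1}t}{1-q^n}&\text{if }\sigma_{n-1}<\sigma_n,\\[2mm] \dfrac{q^{n-1}-t}{1-q^n}&\text{if }\sigma_{n-2}>\sigma_{n-1}>\sigma_n,\\[2mm] \dfrac{(q^{n-1}-q^{n-2}t)(1-t)}{(1-q^{n-2}t)(1-q^n)}&\text{if }\sigma_{n-2}<\sigma_{n-1}>\sigma_n,\end{cases}$$ or equivalently $$\mathbf F_\sigma(\mathbb X)=\partial\mathbf F_\sigma(\mathbb X)\cdot\frac{q^{(n-1)a}-q^{(n-2)b}t}{1-q^{(n-2)b}t}\cdot\frac{1-q^{(n-1)(1-a)}t}{1-q^n},$$ where $a=1$ if $\sigma_{n-1}>\sigma_n$ and $a=0$ otherwise, and $b=1$ if $\sigma_{n-2}<\sigma_{n-1}>\sigma_n$ and $b=0$ otherwise.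
   Context: $\mathrm{std}(w)$ of a word with distinct integer letters is the permutation with the same relative order. For $\mu\in\mathfrak S_N$ and $\epsilon\in\{\pm1\}^N$, the signed permutation $(\mu,\epsilon)$ is identified with the integer word $w=(\epsilon_1\mu_1,\dots,\epsilon_N\mu_N)$; $\mathrm{maj}(\mu,\epsilon)=\sum_{i:\,w_i>w_{i+1}}i$, and $m(\epsilon)$ is the number of entries $-1$ of $\epsilon$. Let $(q)_N=\prod_{i=1}^N(1-q^i)$. For the free quasi-symmetric function $\mathbf F_\mu$ (basis of $\mathbf{FQSym}$), its $(q,t)$-specialization at the virtual alphabet $\mathbb X=\frac1{1-q}\hat\times(1-t)$ is $\mathbf F_\mu(\mathbb X)=\frac{1}{(q)_N}\sum_{\epsilon\in\{\pm1\}^N}(-t)^{m(\epsilon)}q^{\mathrm{maj}(\mu,\epsilon)}$. -}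

module Defs where

open import Level using (Level)
open import Data.Nat as ℕ using (ℕ; zero; suc; _<_; _<?_)
open import Data.Bool using (Bool; true; false; if_then_else_)
open import Data.Fin using (Fin; toℕ; fromℕ<; inject₁) renaming (zero to fzero; suc to fsuc)
open import Data.Fin.Permutation using (Permutation′; _⟨$⟩ʳ_)
open import Data.Integer as ℤ using (ℤ; +_)
open import Data.List using (List; []; _∷_; _++_; map; foldr; concatMap)
open import Data.Vec using (Vec; []; _∷_; lookup)
open import Data.Vec.Functional using (Vector; toList)
open import Data.Maybe using (Maybe; just; nothing)
open import Data.Unit using (⊤)
open import Data.Empty using (⊥)
open import Data.Product using (_×_)
open import Relation.Nullary using (yes; no)
open import Algebra.Bundles using (CommutativeRing)

permWord : ∀ {n} → Permutation′ n → Fin n → ℕ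
permWord σ i = suc (toℕ (σ ⟨$⟩ʳ i))

countBelow : ∀ {k} → (Fin k → ℕ) → ℕ → ℕ
countBelow {zero}  u x = 0
countBelow {suc k} u x with u fzero <? x
... | yes _ = suc (countBelow (λ j → u (fsuc j)) x)
... | no  _ = countBelow (λ j → u (fsuc j)) x

-- std(w): the permutation word with the same relative order as w
-- (for a word with distinct letters: std(w)ᵢ = 1 + #{ j : wⱼ < wᵢ }).
std : ∀ {k} → (Fin k → ℕ) → (Fin k → ℕ)
std u i = suc (countBelow u (u i))

dropLast : ∀ {k} → (Fin (suc k) → ℕ) → (Fin k → ℕ)
dropLast u i = u (inject₁ i)

-- sign vectors ε ∈ {±1}^N; true encodes −1, false encodes +1
allSigns : (N : ℕ) → List (Vec Bool N)
allSigns zero    = [] ∷ []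
allSigns (suc N) = concatMap (λ v → (false ∷ v) ∷ (true ∷ v) ∷ []) (allSigns N)

negCount : ∀ {N} → Vec Bool N → ℕ
negCount []           = 0
negCount (true  ∷ ε)  = suc (negCount ε)
negCount (false ∷ ε)  = negCount ε

signedWord : ∀ {N} → (Fin N → ℕ) → Vec Bool N → Fin N → ℤ
signedWord μ ε i = if lookup ε i then ℤ.- (+ μ i) else + μ i

-- major index of an integer word: majAfter k x ws, where x is the letter at
-- position k and ws the letters at positions k+1, k+2, …
majAfter : ℕ → ℤ → List ℤ → ℕ
majAfter k x []       = 0
majAfter k x (y ∷ ws) with y ℤ.<? x
... | yes _ = k ℕ.+ majAfter (suc k) y ws
... | no  _ = majAfter (suc k) y ws

majFrom : ℕ → List ℤ → ℕ
majFrom k []       = 0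
majFrom k (x ∷ ws) = majAfter k x ws

-- maj(μ,ε) = Σ_{i : wᵢ > wᵢ₊₁} i   (positions 1-based)
maj : ∀ {N} → (Fin N → ℕ) → Vec Bool N → ℕ
maj μ ε = majFrom 1 (toList (signedWord μ ε))

-- The (q,t)-specialization, in an arbitrary commutative ring.
-- F_μ(𝕏) = FXnum μ / (q)_N, where
-- FXnum μ = Σ_{ε ∈ {±1}^N} (−t)^{m(ε)} q^{maj(μ,ε)}.

module Spec {c ℓ : Level} (R : CommutativeRing c ℓ) where
  open CommutativeRing R

  pw : Carrier → ℕ → Carrier
  pw x zero    = 1#
  pw x (suc k) = x * pw x k

  sumL : List Carrier → Carrier
  sumL = foldr _+_ 0#

  qPoch : Carrier → ℕ → Carrier
  qPoch q zero    = 1#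
  qPoch q (suc N) = qPoch q N * (1# - pw q (suc N))

  FXnum : ∀ {N} → Carrier → Carrier → (Fin N → ℕ) → Carrier
  FXnum {N} q t μ =
    sumL (map (λ ε → pw (- t) (negCount ε) * pw q (maj μ ε)) (allSigns N))

-- Letters σ₀, σ₁, …, σₙ with the convention σ₀ = +∞ (encoded as nothing).

letter : ∀ {n} → Permutation′ n → ℕ → Maybe ℕ
letter σ zero = nothing
letter {n} σ (suc i) with i <? n
... | yes p = just (permWord σ (fromℕ< p))
... | no  _ = nothing

_<∞_ : Maybe ℕ → Maybe ℕ → Set
just a  <∞ just b  = a < b
just a  <∞ nothing = ⊤
nothing <∞ _       = ⊥

module Submission where

-- The last two letters of a signed word form a descent according to their signs and relative order only, and
-- standardizing the prefix leaves its descents unchanged. So splitting the sum defining F_σ(𝕏) by the last sign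
-- factors it through ∂F_σ: if σ_{n-1} < σ_n, a final sign −1 adds the descent n−1, giving 1 − q^{n−1}t. If
-- σ_{n-1} > σ_n, the last sign contributes 1 − t, and n−1 is a descent iff the penultimate sign is +1; splitting
-- ∂F_σ by that sign in the same way one level down, its two parts are in ratio −t when σ_{n-2} > σ_{n-1} and
-- −q^{n-2}t when σ_{n-2} < σ_{n-1}.

open import Defs
open import Level using (Level)
open import Data.Nat using (ℕ; suc)
open import Data.Product using (_×_; _,_)
open import Data.Fin.Permutation using (Permutation′)
open import Algebra.Bundles using (CommutativeRing)

module Combinatorics where

  open import Function using (_∘_)
  open import Data.Nat using (zero; _<_; _≤_; _<?_; _+_; z≤n; s≤s; s<s; s<s⁻¹)
  open import Data.Nat.Properties
    using (<-irrefl; <-asym; <-trans; <-≤-trans; <⇒≤; m≤n⇒m≤1+n; ≤⇒≯; ≮⇒≥; +-assoc; +-suc)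
  open import Data.Bool using (Bool; true; false; if_then_else_)
  open import Data.Fin using (Fin; toℕ; fromℕ; inject₁) renaming (zero to fzero; suc to fsuc)
  open import Data.Fin.Properties using (toℕ-fromℕ; toℕ-inject₁; fromℕ<-toℕ; toℕ<n)
  open import Data.Integer as ℤ using (ℤ; +_; +<+; -<+; -<-)
  open import Data.Vec using (Vec; []; _∷_; lookup; _∷ʳ_)
  open import Data.Vec.Functional using (toList)
  open import Data.Maybe using (just)
  open import Relation.Nullary using (yes; no; ¬_; contradiction)
  open import Relation.Binary.PropositionalEquality using (_≡_; refl; sym; trans; cong; cong₂; subst₂; module ≡-Reasoning)

  countBelow-mono : ∀ {K} (u : Fin K → ℕ) {x y} → x ≤ y → countBelow u x ≤ countBelow u y
  countBelow-mono {zero}  u _ = z≤n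
  countBelow-mono {suc K} u {x} {y} x≤y with u fzero <? x | u fzero <? y
  ... | yes _   | yes _   = s≤s (countBelow-mono (u ∘ fsuc) x≤y)
  ... | yes u<x | no u≮y  = contradiction (<-≤-trans u<x x≤y) u≮y
  ... | no _    | yes _   = m≤n⇒m≤1+n (countBelow-mono (u ∘ fsuc) x≤y)
  ... | no _    | no _    = countBelow-mono (u ∘ fsuc) x≤y

  countBelow-letter-< : ∀ {K} (u : Fin K → ℕ) i {y} → u i < y → countBelow u (u i) < countBelow u y
  countBelow-letter-< {suc K} u fzero {y} uᵢ<y with u fzero <? u fzero | u fzero <? y
  ... | yes u<u | _       = contradiction u<u (<-irrefl refl)
  ... | no _    | yes _   = s≤s (countBelow-mono (u ∘ fsuc) (<⇒≤ uᵢ<y))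
  ... | no _    | no u≮y  = contradiction uᵢ<y u≮y
  countBelow-letter-< {suc K} u (fsuc i) {y} uᵢ<y with u fzero <? u (fsuc i) | u fzero <? y
  ... | yes _   | yes _   = s≤s (countBelow-letter-< (u ∘ fsuc) i uᵢ<y)
  ... | yes u<uᵢ | no u≮y = contradiction (<-trans u<uᵢ uᵢ<y) u≮y
  ... | no _    | yes _   = m≤n⇒m≤1+n (countBelow-letter-< (u ∘ fsuc) i uᵢ<y)
  ... | no _    | no _    = countBelow-letter-< (u ∘ fsuc) i uᵢ<y

  std-preserves-< : ∀ {K} (u : Fin K → ℕ) i j → u i < u j → std u i < std u j
  std-preserves-< u i j uᵢ<uⱼ = s≤s (countBelow-letter-< u i uᵢ<uⱼ)

  std-reflects-< : ∀ {K} (u : Fin K → ℕ) i j → std u i < std u j → u i < u j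
  std-reflects-< u i j stdᵢ<stdⱼ with u i <? u j
  ... | yes uᵢ<uⱼ = uᵢ<uⱼ
  ... | no uᵢ≮uⱼ  = contradiction stdᵢ<stdⱼ (≤⇒≯ (s≤s (countBelow-mono u (≮⇒≥ uᵢ≮uⱼ))))

  -- Only positive letters are ever signed (words are written suc ∘ μ): a letter 0 would have −0 = +0.
  signed : Bool → ℕ → ℤ
  signed s x = if s then ℤ.- (+ x) else + x

  signed-<-transfer : ∀ {a b a′ b′} → (suc a < suc b → suc a′ < suc b′) → (suc b < suc a → suc b′ < suc a′) →
                      ∀ s s′ → signed s (suc a) ℤ.< signed s′ (suc b) → signed s (suc a′) ℤ.< signed s′ (suc b′)
  signed-<-transfer mono _    false false (+<+ a<b) = +<+ (mono a<b)
  signed-<-transfer _    mono true  true  (-<- b<a) = -<- (s<s⁻¹ (mono (s<s b<a)))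
  signed-<-transfer _    _    true  false _         = -<+
  signed-<-transfer _    _    false true  ()

  descentIndex : ℤ → ℤ → ℕ → ℕ
  descentIndex x y j with y ℤ.<? x
  ... | yes _ = j
  ... | no  _ = 0

  descentIndex-yes : ∀ {x y} j → y ℤ.< x → descentIndex x y j ≡ j
  descentIndex-yes {x} {y} j y<x with y ℤ.<? x
  ... | yes _   = refl
  ... | no y≮x  = contradiction y<x y≮x

  descentIndex-no : ∀ {x y} j → ¬ y ℤ.< x → descentIndex x y j ≡ 0
  descentIndex-no {x} {y} j y≮x with y ℤ.<? x
  ... | yes y<x = contradiction y<x y≮x
  ... | no _    = refl

  descentIndex-signed-ascent : ∀ {a b} s s′ j → suc a < suc b →
                               descentIndex (signed s (suc a)) (signed s′ (suc b)) j ≡ (if s′ then j else 0)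
  descentIndex-signed-ascent         false false j a<b = descentIndex-no j λ { (+<+ b<a) → <-asym b<a a<b }
  descentIndex-signed-ascent {a} {b} true  false j _   = descentIndex-no {ℤ.-[1+ a ]} {+ suc b} j λ ()
  descentIndex-signed-ascent {a} {b} false true  j _   = descentIndex-yes {+ suc a} {ℤ.-[1+ b ]} j -<+
  descentIndex-signed-ascent         true  true  j a<b = descentIndex-yes j (-<- (s<s⁻¹ a<b))

  descentIndex-signed-descent : ∀ {a b} s s′ j → suc b < suc a →
                                descentIndex (signed s (suc a)) (signed s′ (suc b)) j ≡ (if s then 0 else j)
  descentIndex-signed-descent         false false j b<a = descentIndex-yes j (+<+ b<a)
  descentIndex-signed-descent {a} {b} false true  j _   = descentIndex-yes {+ suc a} {ℤ.-[1+ b ]} j -<+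
  descentIndex-signed-descent {a} {b} true  false j _   = descentIndex-no {ℤ.-[1+ a ]} {+ suc b} j λ ()
  descentIndex-signed-descent         true  true  j b<a = descentIndex-no j λ { (-<- a<b) → <-asym a<b (s<s⁻¹ b<a) }

  penultimate : ∀ M → Fin (suc (suc M))
  penultimate M = inject₁ (fromℕ M)

  majWord : ∀ {M} → ℕ → (Fin (suc M) → ℤ) → ℕ
  majWord j w = majAfter j (w fzero) (toList (w ∘ fsuc))

  majWord-cong : ∀ {M} j (w w′ : Fin (suc M) → ℤ) →
                 (∀ i i′ → w i ℤ.< w i′ → w′ i ℤ.< w′ i′) → (∀ i i′ → w′ i ℤ.< w′ i′ → w i ℤ.< w i′) →
                 majWord j w ≡ majWord j w′
  majWord-cong {zero}  j w w′ _  _    = refl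
  majWord-cong {suc M} j w w′ to from with w (fsuc fzero) ℤ.<? w fzero | w′ (fsuc fzero) ℤ.<? w′ fzero
  ... | yes _  | yes _  = cong (_+_ j) (majWord-cong (suc j) (w ∘ fsuc) (w′ ∘ fsuc)
                                                    (λ i → to (fsuc i) ∘ fsuc) (λ i → from (fsuc i) ∘ fsuc))
  ... | yes p  | no ¬q  = contradiction (to _ _ p) ¬q
  ... | no ¬p  | yes q  = contradiction (from _ _ q) ¬p
  ... | no _   | no _   = majWord-cong (suc j) (w ∘ fsuc) (w′ ∘ fsuc)
                                       (λ i → to (fsuc i) ∘ fsuc) (λ i → from (fsuc i) ∘ fsuc)

  majWord-split-last : ∀ M j (w : Fin (suc (suc M)) → ℤ) →
                       majWord j w ≡ majWord j (w ∘ inject₁) + descentIndex (w (penultimate M)) (w (fromℕ (suc M))) (j + M)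
  majWord-split-last zero j w with w (fsuc fzero) ℤ.<? w fzero
  ... | yes _ = refl
  ... | no  _ = refl
  majWord-split-last (suc M) j w rewrite +-suc j M with w (fsuc fzero) ℤ.<? w fzero
  ... | yes _ = trans (cong (_+_ j) (majWord-split-last M (suc j) (w ∘ fsuc))) (sym (+-assoc j _ _))
  ... | no  _ = majWord-split-last M (suc j) (w ∘ fsuc)

  lookup-∷ʳ-inject₁ : ∀ {A : Set} {N} (e : Vec A N) x i → lookup (e ∷ʳ x) (inject₁ i) ≡ lookup e i
  lookup-∷ʳ-inject₁ (y ∷ e) x fzero    = refl
  lookup-∷ʳ-inject₁ (y ∷ e) x (fsuc i) = lookup-∷ʳ-inject₁ e x i

  lookup-∷ʳ-fromℕ : ∀ {A : Set} {N} (e : Vec A N) x → lookup (e ∷ʳ x) (fromℕ N) ≡ x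
  lookup-∷ʳ-fromℕ []      x = refl
  lookup-∷ʳ-fromℕ (y ∷ e) x = lookup-∷ʳ-fromℕ e x

  negCount-∷ʳ : ∀ {N} (e : Vec Bool N) s → negCount (e ∷ʳ s) ≡ negCount e + negCount (s ∷ [])
  negCount-∷ʳ []          s = refl
  negCount-∷ʳ (true  ∷ e) s = cong suc (negCount-∷ʳ e s)
  negCount-∷ʳ (false ∷ e) s = negCount-∷ʳ e s

  ∂ : ∀ {K} → (Fin (suc K) → ℕ) → Fin K → ℕ
  ∂ w = std (dropLast w)

  -- ∂ w is suc ∘ ∂₀ w by the definition of std, so derived words are again words of positive letters.
  ∂₀ : ∀ {K} → (Fin (suc K) → ℕ) → Fin K → ℕ
  ∂₀ w i = countBelow (dropLast w) (dropLast w i)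

  lastDescent : ∀ M → (Fin (suc (suc M)) → ℕ) → Vec Bool (suc M) → Bool → ℕ
  lastDescent M μ e s =
    descentIndex (signed (lookup e (fromℕ M)) (suc (μ (penultimate M))))
                 (signed s (suc (μ (fromℕ (suc M))))) (suc M)

  maj-∷ʳ : ∀ M (μ : Fin (suc (suc M)) → ℕ) e s →
           maj (suc ∘ μ) (e ∷ʳ s) ≡ maj (∂ (suc ∘ μ)) e + lastDescent M μ e s
  maj-∷ʳ M μ e s = begin
      maj (suc ∘ μ) (e ∷ʳ s)
    ≡⟨ majWord-split-last M 1 w ⟩
      majWord 1 (w ∘ inject₁) + descentIndex (w (penultimate M)) (w (fromℕ (suc M))) (suc M)
    ≡⟨ cong₂ _+_ (majWord-cong 1 (w ∘ inject₁) (signedWord ν e) to from)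
                 (cong₂ (λ x y → descentIndex x y (suc M))
                        (cong (λ s′ → signed s′ (suc (μ (penultimate M)))) (lookup-∷ʳ-inject₁ e s (fromℕ M)))
                        (cong (λ s′ → signed s′ (suc (μ (fromℕ (suc M))))) (lookup-∷ʳ-fromℕ e s))) ⟩
      maj ν e + lastDescent M μ e s ∎
    where
    open ≡-Reasoning
    w = signedWord (suc ∘ μ) (e ∷ʳ s)
    ν = ∂ (suc ∘ μ)
    w-inject₁ : ∀ i → w (inject₁ i) ≡ signedWord (dropLast (suc ∘ μ)) e i
    w-inject₁ i = cong (λ s′ → signed s′ (suc (μ (inject₁ i)))) (lookup-∷ʳ-inject₁ e s i)
    to : ∀ i i′ → w (inject₁ i) ℤ.< w (inject₁ i′) → signedWord ν e i ℤ.< signedWord ν e i′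
    to i i′ wᵢ<wᵢ′ =
      signed-<-transfer (std-preserves-< _ i i′) (std-preserves-< _ i′ i) (lookup e i) (lookup e i′)
                        (subst₂ ℤ._<_ (w-inject₁ i) (w-inject₁ i′) wᵢ<wᵢ′)
    from : ∀ i i′ → signedWord ν e i ℤ.< signedWord ν e i′ → w (inject₁ i) ℤ.< w (inject₁ i′)
    from i i′ νᵢ<νᵢ′ =
      subst₂ ℤ._<_ (sym (w-inject₁ i)) (sym (w-inject₁ i′))
             (signed-<-transfer (std-reflects-< _ i i′) (std-reflects-< _ i′ i) (lookup e i) (lookup e i′) νᵢ<νᵢ′)

  lastDescent-ascent : ∀ M (μ : Fin (suc (suc M)) → ℕ) e s → suc (μ (penultimate M)) < suc (μ (fromℕ (suc M))) →
                       lastDescent M μ e s ≡ (if s then suc M else 0)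
  lastDescent-ascent M μ e s = descentIndex-signed-ascent (lookup e (fromℕ M)) s (suc M)

  lastDescent-descent : ∀ M (μ : Fin (suc (suc M)) → ℕ) e c s → suc (μ (fromℕ (suc M))) < suc (μ (penultimate M)) →
                        lastDescent M μ (e ∷ʳ c) s ≡ (if c then 0 else suc M)
  lastDescent-descent M μ e c s last<pen =
    trans (cong (λ c′ → descentIndex (signed c′ (suc (μ (penultimate M)))) (signed s (suc (μ (fromℕ (suc M))))) (suc M))
                (lookup-∷ʳ-fromℕ e c))
          (descentIndex-signed-descent c s (suc M) last<pen)

  toℕ-penultimate : ∀ M → toℕ (penultimate M) ≡ M
  toℕ-penultimate M = trans (toℕ-inject₁ (fromℕ M)) (toℕ-fromℕ M)

  toℕ-antepenultimate : ∀ M → toℕ (inject₁ (penultimate M)) ≡ M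
  toℕ-antepenultimate M = trans (toℕ-inject₁ (penultimate M)) (toℕ-penultimate M)

  letter-suc : ∀ {n} (σ : Permutation′ n) (i : Fin n) {m} → toℕ i ≡ m → letter σ (suc m) ≡ just (permWord σ i)
  letter-suc {n} σ i refl with toℕ i <? n
  ... | yes i<n = cong (just ∘ permWord σ) (fromℕ<-toℕ i i<n)
  ... | no i≮n  = contradiction (toℕ<n i) i≮n

  <∞⇒permWord-< : ∀ {n} (σ : Permutation′ n) {i j : Fin n} {a b} → toℕ i ≡ a → toℕ j ≡ b →
                  letter σ (suc a) <∞ letter σ (suc b) → permWord σ i < permWord σ j
  <∞⇒permWord-< σ {i} {j} i≡a j≡b rewrite letter-suc σ i i≡a | letter-suc σ j j≡b = λ σᵢ<σⱼ → σᵢ<σⱼ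

module Specialization {c ℓ : Level} (R : CommutativeRing c ℓ) (q t : CommutativeRing.Carrier R) where
  open Combinatorics
  open import Function using (_∘_)
  open import Data.Nat as ℕ using (zero; _<_)
  open import Data.Bool using (Bool; true; false; if_then_else_)
  open import Data.Fin using (Fin; toℕ; fromℕ)
  open import Data.Fin.Properties using (toℕ-fromℕ)
  open import Data.Fin.Permutation using (_⟨$⟩ʳ_)
  open import Data.List using ([]; _∷_; map; concatMap)
  open import Data.Vec using (Vec; []; _∷_; _∷ʳ_)
  open import Data.Product using (proj₁; proj₂)
  import Relation.Binary.PropositionalEquality as ≡
  open CommutativeRing R
  open Spec R
  open import Algebra.Properties.Ring ring using (-‿distribˡ-*)
  open import Algebra.Properties.CommutativeSemigroup +-commutativeSemigroup using () renaming (interchange to +-interchange)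
  open import Algebra.Properties.CommutativeSemigroup *-commutativeSemigroup using () renaming (interchange to *-interchange)
  open import Algebra.Solver.CommutativeMonoid *-commutativeMonoid using (solve; _⊕_; _⊜_)
  open import Relation.Binary.Reasoning.Setoid setoid

  signSum : ∀ N → (Vec Bool N → Carrier) → Carrier
  signSum zero    f = f []
  signSum (suc N) f = signSum N (λ e → f (false ∷ e)) + signSum N (λ e → f (true ∷ e))

  sumL-pairs : ∀ {N} (f : Vec Bool (suc N) → Carrier) es →
               sumL (map f (concatMap (λ e → (false ∷ e) ∷ (true ∷ e) ∷ []) es))
                 ≈ sumL (map (λ e → f (false ∷ e)) es) + sumL (map (λ e → f (true ∷ e)) es)
  sumL-pairs f []       = sym (+-identityˡ 0#)
  sumL-pairs f (e ∷ es) =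
    trans (+-congˡ (+-congˡ (sumL-pairs f es))) (trans (sym (+-assoc _ _ _)) (+-interchange _ _ _ _))

  sumL-allSigns : ∀ N f → sumL (map f (allSigns N)) ≈ signSum N f
  sumL-allSigns zero    f = +-identityʳ (f [])
  sumL-allSigns (suc N) f = trans (sumL-pairs f (allSigns N)) (+-cong (sumL-allSigns N _) (sumL-allSigns N _))

  signSum-cong : ∀ N {f g} → (∀ e → f e ≈ g e) → signSum N f ≈ signSum N g
  signSum-cong zero    f≈g = f≈g []
  signSum-cong (suc N) f≈g = +-cong (signSum-cong N (λ e → f≈g (false ∷ e))) (signSum-cong N (λ e → f≈g (true ∷ e)))

  signSum-*ʳ : ∀ N f x → signSum N (λ e → f e * x) ≈ signSum N f * x
  signSum-*ʳ zero    f x = refl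
  signSum-*ʳ (suc N) f x = trans (+-cong (signSum-*ʳ N _ x) (signSum-*ʳ N _ x)) (sym (distribʳ x _ _))

  signSum-∷ʳ : ∀ N f → signSum (suc N) f ≈ signSum N (λ e → f (e ∷ʳ false)) + signSum N (λ e → f (e ∷ʳ true))
  signSum-∷ʳ zero    f = refl
  signSum-∷ʳ (suc N) f =
    trans (+-cong (signSum-∷ʳ N (λ e → f (false ∷ e))) (signSum-∷ʳ N (λ e → f (true ∷ e)))) (+-interchange _ _ _ _)

  pw-+ : ∀ x m n → pw x (m ℕ.+ n) ≈ pw x m * pw x n
  pw-+ x zero    n = sym (*-identityˡ _)
  pw-+ x (suc m) n = trans (*-congˡ (pw-+ x m n)) (sym (*-assoc _ _ _))

  weight : ∀ {N} → (Fin N → ℕ) → Vec Bool N → Carrier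
  weight μ e = pw (- t) (negCount e) * pw q (maj μ e)

  signWeight : Bool → Carrier
  signWeight s = pw (- t) (negCount (s ∷ []))

  FXnum≈signSum : ∀ {N} (μ : Fin N → ℕ) → FXnum q t μ ≈ signSum N (weight μ)
  FXnum≈signSum {N} μ = sumL-allSigns N (weight μ)

  weight-∷ʳ : ∀ M (μ : Fin (suc (suc M)) → ℕ) e s →
              weight (suc ∘ μ) (e ∷ʳ s) ≈ weight (∂ (suc ∘ μ)) e * (signWeight s * pw q (lastDescent M μ e s))
  weight-∷ʳ M μ e s = begin
    pw (- t) (negCount (e ∷ʳ s)) * pw q (maj (suc ∘ μ) (e ∷ʳ s))
      ≈⟨ *-cong (trans (reflexive (≡.cong (pw (- t)) (negCount-∷ʳ e s))) (pw-+ (- t) (negCount e) _))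
                (trans (reflexive (≡.cong (pw q) (maj-∷ʳ M μ e s))) (pw-+ q (maj (∂ (suc ∘ μ)) e) _)) ⟩
    (pw (- t) (negCount e) * signWeight s) * (pw q (maj (∂ (suc ∘ μ)) e) * pw q (lastDescent M μ e s))
      ≈⟨ *-interchange _ _ _ _ ⟩
    weight (∂ (suc ∘ μ)) e * (signWeight s * pw q (lastDescent M μ e s)) ∎

  endingSum : ∀ {N} → Bool → (Fin (suc N) → ℕ) → Carrier
  endingSum {N} s w = signSum N (λ e → weight w (e ∷ʳ s))

  FXnum-endingSum : ∀ {N} (w : Fin (suc N) → ℕ) → FXnum q t w ≈ endingSum false w + endingSum true w
  FXnum-endingSum {N} w = trans (FXnum≈signSum w) (signSum-∷ʳ N (weight w))

  factor-subʳ : ∀ x y a → x * a + - y * a ≈ (x - y) * a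
  factor-subʳ x y a = sym (distribʳ a x (- y))

  factor-one-subʳ : ∀ y a → a + - y * a ≈ (1# - y) * a
  factor-one-subʳ y a = trans (+-congʳ (sym (*-identityˡ a))) (factor-subʳ 1# y a)

  endingSum-ascent : ∀ k (μ : Fin (suc (suc k)) → ℕ) → suc (μ (penultimate k)) < suc (μ (fromℕ (suc k))) →
                     endingSum false (suc ∘ μ) ≈ FXnum q t (∂ (suc ∘ μ))
                     × endingSum true (suc ∘ μ) ≈ - (pw q (suc k) * t) * FXnum q t (∂ (suc ∘ μ))
  endingSum-ascent k μ pen<last =
      trans (factored false) (trans (*-congˡ (*-identityʳ 1#)) (*-identityʳ D))
    , (begin
      endingSum true (suc ∘ μ)        ≈⟨ factored true ⟩
      D * ((- t * 1#) * Q)            ≈⟨ *-congˡ (*-congʳ (*-identityʳ (- t))) ⟩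
      D * (- t * Q)                   ≈⟨ *-congˡ (sym (-‿distribˡ-* t Q)) ⟩
      D * - (t * Q)                   ≈⟨ *-congˡ (-‿cong (*-comm t Q)) ⟩
      D * - (Q * t)                   ≈⟨ *-comm D _ ⟩
      - (Q * t) * D                   ∎)
    where
    ν = ∂ (suc ∘ μ)
    D = FXnum q t ν
    Q = pw q (suc k)
    factored : ∀ s → endingSum s (suc ∘ μ) ≈ D * (signWeight s * pw q (if s then suc k else 0))
    factored s = begin
      endingSum s (suc ∘ μ)
        ≈⟨ signSum-cong (suc k) (λ e → trans (weight-∷ʳ k μ e s)
             (*-congˡ (*-congˡ (reflexive (≡.cong (pw q) (lastDescent-ascent k μ e s pen<last)))))) ⟩
      signSum (suc k) (λ e → weight ν e * (signWeight s * pw q (if s then suc k else 0)))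
        ≈⟨ signSum-*ʳ (suc k) (weight ν) _ ⟩
      signSum (suc k) (weight ν) * (signWeight s * pw q (if s then suc k else 0))
        ≈⟨ *-congʳ (sym (FXnum≈signSum ν)) ⟩
      D * (signWeight s * pw q (if s then suc k else 0)) ∎

  endingSum-descent : ∀ k (μ : Fin (suc (suc k)) → ℕ) → suc (μ (fromℕ (suc k))) < suc (μ (penultimate k)) →
                      let ν = ∂ (suc ∘ μ)
                          Y = pw q (suc k) * endingSum false ν + endingSum true ν
                      in endingSum false (suc ∘ μ) ≈ Y × endingSum true (suc ∘ μ) ≈ - t * Y
  endingSum-descent k μ last<pen =
      trans (factored false) (*-identityʳ Y)
    , trans (factored true) (trans (*-congˡ (*-identityʳ (- t))) (*-comm Y (- t)))
    where
    ν = ∂ (suc ∘ μ)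
    Q = pw q (suc k)
    Y = Q * endingSum false ν + endingSum true ν
    byLastSign : ∀ s c → signSum k (λ e → weight (suc ∘ μ) (e ∷ʳ c ∷ʳ s))
                           ≈ endingSum c ν * (signWeight s * pw q (if c then 0 else suc k))
    byLastSign s c =
      trans (signSum-cong k (λ e → trans (weight-∷ʳ k μ (e ∷ʳ c) s)
                 (*-congˡ (*-congˡ (reflexive (≡.cong (pw q) (lastDescent-descent k μ e c s last<pen)))))))
            (signSum-*ʳ k _ _)
    factored : ∀ s → endingSum s (suc ∘ μ) ≈ Y * signWeight s
    factored s = begin
      endingSum s (suc ∘ μ)
        ≈⟨ signSum-∷ʳ k (λ e → weight (suc ∘ μ) (e ∷ʳ s)) ⟩
      signSum k (λ e → weight (suc ∘ μ) (e ∷ʳ false ∷ʳ s)) + signSum k (λ e → weight (suc ∘ μ) (e ∷ʳ true ∷ʳ s))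
        ≈⟨ +-cong (byLastSign s false) (byLastSign s true) ⟩
      endingSum false ν * (signWeight s * Q) + endingSum true ν * (signWeight s * 1#)
        ≈⟨ +-cong (solve 3 (λ A w Q → A ⊕ (w ⊕ Q) ⊜ (Q ⊕ A) ⊕ w) refl (endingSum false ν) (signWeight s) Q)
                  (*-congˡ (*-identityʳ (signWeight s))) ⟩
      Q * endingSum false ν * signWeight s + endingSum true ν * signWeight s
        ≈⟨ sym (distribʳ _ _ _) ⟩
      Y * signWeight s ∎

  FXnum-ascent : ∀ k (μ : Fin (suc (suc k)) → ℕ) → suc (μ (penultimate k)) < suc (μ (fromℕ (suc k))) →
                 FXnum q t (suc ∘ μ) ≈ FXnum q t (∂ (suc ∘ μ)) * (1# - pw q (suc k) * t)
  FXnum-ascent k μ pen<last = begin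
    FXnum q t (suc ∘ μ)                                   ≈⟨ FXnum-endingSum (suc ∘ μ) ⟩
    endingSum false (suc ∘ μ) + endingSum true (suc ∘ μ)  ≈⟨ +-cong A₀ A₁ ⟩
    D + - (pw q (suc k) * t) * D                          ≈⟨ factor-one-subʳ _ D ⟩
    (1# - pw q (suc k) * t) * D                           ≈⟨ *-comm _ D ⟩
    D * (1# - pw q (suc k) * t)                           ∎
    where
    D = FXnum q t (∂ (suc ∘ μ))
    A₀ = proj₁ (endingSum-ascent k μ pen<last)
    A₁ = proj₂ (endingSum-ascent k μ pen<last)

  FXnum-descent : ∀ k (μ : Fin (suc (suc k)) → ℕ) → suc (μ (fromℕ (suc k))) < suc (μ (penultimate k)) →
                  let ν = ∂ (suc ∘ μ) in
                  FXnum q t (suc ∘ μ) ≈ (1# - t) * (pw q (suc k) * endingSum false ν + endingSum true ν)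
  FXnum-descent k μ last<pen =
    trans (FXnum-endingSum (suc ∘ μ)) (trans (+-cong (proj₁ factors) (proj₂ factors)) (factor-one-subʳ t _))
    where factors = endingSum-descent k μ last<pen

  FXnum-double-descent : ∀ k (μ : Fin (suc (suc k)) → ℕ) → suc (μ (fromℕ (suc k))) < suc (μ (penultimate k)) →
                         let ν = ∂ (suc ∘ μ) in
                         endingSum true ν ≈ - t * endingSum false ν →
                         FXnum q t (suc ∘ μ) ≈ FXnum q t ν * (pw q (suc k) - t)
  FXnum-double-descent k μ last<pen A₁≈-tA₀ = begin
    FXnum q t (suc ∘ μ)        ≈⟨ FXnum-descent k μ last<pen ⟩
    (1# - t) * (Q * A₀ + A₁)   ≈⟨ *-congˡ (trans (+-congˡ A₁≈-tA₀) (factor-subʳ Q t A₀)) ⟩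
    (1# - t) * ((Q - t) * A₀)  ≈⟨ solve 3 (λ x y a → x ⊕ (y ⊕ a) ⊜ (x ⊕ a) ⊕ y) refl (1# - t) (Q - t) A₀ ⟩
    (1# - t) * A₀ * (Q - t)    ≈⟨ *-congʳ ∂F≈ ⟨
    FXnum q t ν * (Q - t)      ∎
    where
    ν = ∂ (suc ∘ μ)
    Q = pw q (suc k)
    A₀ = endingSum false ν
    A₁ = endingSum true ν
    ∂F≈ : FXnum q t ν ≈ (1# - t) * A₀
    ∂F≈ = trans (FXnum-endingSum ν) (trans (+-congˡ A₁≈-tA₀) (factor-one-subʳ t A₀))

  FXnum-peak : ∀ k (μ : Fin (suc (suc (suc k))) → ℕ) →
               suc (μ (fromℕ (suc (suc k)))) < suc (μ (penultimate (suc k))) →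
               ∂ (suc ∘ μ) (penultimate k) < ∂ (suc ∘ μ) (fromℕ (suc k)) →
               FXnum q t (suc ∘ μ) * (1# - pw q (suc k) * t)
                 ≈ FXnum q t (∂ (suc ∘ μ)) * ((pw q (suc (suc k)) - pw q (suc k) * t) * (1# - t))
  FXnum-peak k μ last<pen ∂pen<∂last = begin
    FXnum q t (suc ∘ μ) * (1# - K * t)
      ≈⟨ *-congʳ (FXnum-descent (suc k) μ last<pen) ⟩
    (1# - t) * (Q * endingSum false ν + endingSum true ν) * (1# - K * t)
      ≈⟨ *-congʳ (*-congˡ (trans (+-cong (*-congˡ (proj₁ factors)) (proj₂ factors)) (factor-subʳ Q (K * t) D))) ⟩
    (1# - t) * ((Q - K * t) * D) * (1# - K * t)
      ≈⟨ solve 4 (λ x y d z → (x ⊕ (y ⊕ d)) ⊕ z ⊜ (d ⊕ z) ⊕ (y ⊕ x)) refl (1# - t) (Q - K * t) D (1# - K * t) ⟩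
    D * (1# - K * t) * ((Q - K * t) * (1# - t))
      ≈⟨ *-congʳ (FXnum-ascent k (∂₀ (suc ∘ μ)) ∂pen<∂last) ⟨
    FXnum q t ν * ((Q - K * t) * (1# - t)) ∎
    where
    ν = ∂ (suc ∘ μ)
    D = FXnum q t (∂ ν)
    K = pw q (suc k)
    Q = pw q (suc (suc k))
    factors = endingSum-ascent k (∂₀ (suc ∘ μ)) ∂pen<∂last

  FXnum-permWord-ascent : ∀ k (σ : Permutation′ (suc (suc k))) → letter σ (suc k) <∞ letter σ (suc (suc k)) →
                          FXnum q t (permWord σ) ≈ FXnum q t (∂ (permWord σ)) * (1# - pw q (suc k) * t)
  FXnum-permWord-ascent k σ pen<last =
    FXnum-ascent k (toℕ ∘ (σ ⟨$⟩ʳ_)) (<∞⇒permWord-< σ (toℕ-penultimate k) (toℕ-fromℕ (suc k)) pen<last)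

  -- For k = 0 the derived word has a single letter, which matches the convention σ₀ = +∞.
  endingSum-∂-permWord : ∀ k (σ : Permutation′ (suc (suc k))) → letter σ (suc k) <∞ letter σ k →
                         endingSum true (∂ (permWord σ)) ≈ - t * endingSum false (∂ (permWord σ))
  endingSum-∂-permWord zero    σ _          = *-assoc (- t) 1# 1#
  endingSum-∂-permWord (suc k) σ pen<ante   = trans (proj₂ factors) (*-congˡ (sym (proj₁ factors)))
    where
    ∂last<∂pen : ∂ (permWord σ) (fromℕ (suc k)) < ∂ (permWord σ) (penultimate k)
    ∂last<∂pen = std-preserves-< (dropLast (permWord σ)) (fromℕ (suc k)) (penultimate k)
                   (<∞⇒permWord-< σ (toℕ-penultimate (suc k)) (toℕ-antepenultimate k) pen<ante)
    factors = endingSum-descent k (∂₀ (permWord σ)) ∂last<∂pen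

  FXnum-permWord-double-descent : ∀ k (σ : Permutation′ (suc (suc k))) →
                                  letter σ (suc (suc k)) <∞ letter σ (suc k) → letter σ (suc k) <∞ letter σ k →
                                  FXnum q t (permWord σ) ≈ FXnum q t (∂ (permWord σ)) * (pw q (suc k) - t)
  FXnum-permWord-double-descent k σ last<pen pen<ante =
    FXnum-double-descent k (toℕ ∘ (σ ⟨$⟩ʳ_)) (<∞⇒permWord-< σ (toℕ-fromℕ (suc k)) (toℕ-penultimate k) last<pen)
                         (endingSum-∂-permWord k σ pen<ante)

  FXnum-permWord-peak : ∀ k (σ : Permutation′ (suc (suc k))) →
                        letter σ (suc (suc k)) <∞ letter σ (suc k) → letter σ k <∞ letter σ (suc k) →
                        FXnum q t (permWord σ) * (1# - pw q k * t)
                          ≈ FXnum q t (∂ (permWord σ)) * ((pw q (suc k) - pw q k * t) * (1# - t))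
  FXnum-permWord-peak zero    σ _        ()
  FXnum-permWord-peak (suc k) σ last<pen ante<pen =
    FXnum-peak k (toℕ ∘ (σ ⟨$⟩ʳ_))
               (<∞⇒permWord-< σ (toℕ-fromℕ (suc (suc k))) (toℕ-penultimate (suc k)) last<pen)
               (std-preserves-< (dropLast (permWord σ)) (penultimate k) (fromℕ (suc k))
                  (<∞⇒permWord-< σ (toℕ-antepenultimate k) (toℕ-penultimate (suc k)) ante<pen))

  clear-denominators : ∀ {a b x p r} → a ≈ b * x → a * p * r ≈ b * x * (p * r)
  clear-denominators a≈bx = trans (*-assoc _ _ _) (*-congʳ a≈bx)

  clear-denominators′ : ∀ {a b x y p r} → a * y ≈ b * x → a * p * (y * r) ≈ b * x * (p * r)
  clear-denominators′ {a} {b} {x} {y} {p} {r} ay≈bx =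
    trans (solve 4 (λ a p y r → (a ⊕ p) ⊕ (y ⊕ r) ⊜ (a ⊕ y) ⊕ (p ⊕ r)) refl a p y r) (*-congʳ ay≈bx)

corollary3p10 : ∀ {c ℓ} (R : CommutativeRing c ℓ) (k : ℕ) (σ : Permutation′ (suc (suc k))) (q t : CommutativeRing.Carrier R) →
    let open CommutativeRing R
        open Spec R
        n = suc (suc k)
        Fσ = FXnum q t (permWord σ)
        ∂Fσ = FXnum q t (std (dropLast (permWord σ)))
    in ((letter σ (suc k) <∞ letter σ n) →
          Fσ * qPoch q (suc k) * (1# - pw q n)
            ≈ ∂Fσ * (1# - pw q (suc k) * t) * qPoch q n)
     × ((letter σ n <∞ letter σ (suc k)) × (letter σ (suc k) <∞ letter σ k) →
          Fσ * qPoch q (suc k) * (1# - pw q n)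
            ≈ ∂Fσ * (pw q (suc k) - t) * qPoch q n)
     × ((letter σ n <∞ letter σ (suc k)) × (letter σ k <∞ letter σ (suc k)) →
          Fσ * qPoch q (suc k) * ((1# - pw q k * t) * (1# - pw q n))
            ≈ ∂Fσ * ((pw q (suc k) - pw q k * t) * (1# - t)) * qPoch q n)
corollary3p10 R k σ q t =
    (λ pen<last → clear-denominators (FXnum-permWord-ascent k σ pen<last))
  , (λ { (last<pen , pen<ante) → clear-denominators (FXnum-permWord-double-descent k σ last<pen pen<ante) })
  , (λ { (last<pen , ante<pen) → clear-denominators′ (FXnum-permWord-peak k σ last<pen ante<pen) })
  where open Specialization R q t
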